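{- Let $G'$ be a finite directed (multi)graph on nodes $\{1,\dots,v'\}$ with $e'$ edges and no isolated nodes, and let $f:\mathbf{N}\to\mathbf{N}$ satisfy $f(0)=e'$, $f(t)=0$ for $1\le t\le v'-1$, $f(t)\ge1$ for $t\ge v'$. Let $F(t)=\sum_{i=0}^{t-1}f(i)$ and suppose $\sum_{s=1}^\infty \frac{f(s)}{F(s)}=\infty$. Consider either of the processes $\mathrm{MPA}_f(G')$ or $\mathrm{GPA}_f(G')$ (in the latter case assuming $f(t)\le t$ for all $t\ge v'$ and $G'$ a directed graph). Then for any stage $t_0$, any possible state $G(t_0)$ of the process, and any node $u$ of $G(t_0)$, the conditional probability, given $G(t_0)$, that $u$ never receives another edge after stage $t_0$ is $0$.
   Context: Both processes set $G(1)=\dots=G(v')=G'$ and, for $t\ge v'$, obtain $G(t+1)$ from $G(t)$ (node set $\{1,\dots,t\}$, $F(t)$ edges) by adding a new node $t+1$ and $f(t)$ new directed edges starting at $t+1$, whose end-points are chosen from $\{1,\dots,t\}$ with probabilities proportional to the nodes' degrees $d_u(t)$ in $G(t)$ (the degree counting edge multiplicities, ignoring direction). In $\mathrm{MPA}_f$ the end-points are chosen independently with replacement, each equal to $u$ with probability $d_u(t)/(2F(t))$, so multiple edges may arise; in $\mathrm{GPA}_f$ they are chosen without replacement, so the result is a graph. -}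

module Defs where

open import Data.Nat as ℕ using (ℕ; zero; suc; _∸_; _≤_; _<_)
open import Data.Integer using (+_)
open import Data.Rational using (ℚ; 0ℚ; 1ℚ; _/_) renaming (_+_ to _+ℚ_; _*_ to _*ℚ_)
open import Data.Bool using (Bool; true; false; if_then_else_)
open import Data.Product using (_×_; _,_; proj₁; proj₂)
open import Data.List using (List; []; _∷_; map; upTo; _++_; concatMap; filter; length)
open import Data.List.Membership.Propositional using (_∈_)
open import Relation.Nullary.Decidable using (⌊_⌋; ¬?)
open import Data.Nat.Properties using (_≟_)
open import Relation.Binary.PropositionalEquality using (_≡_; _≢_)
open import Data.List.Relation.Unary.Unique.Propositional using (Unique)
open import Data.Rational using () renaming (_<_ to _<ℚ_)
open import Data.List.Membership.DecPropositional _≟_ using (_∈?_)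

-- A directed edge (source , target); nodes are positive naturals.
Edge : Set
Edge = ℕ × ℕ

data Model : Set where
  MPA GPA : Model

F : (ℕ → ℕ) → ℕ → ℕ
F f zero = zero
F f (suc t) = F f t ℕ.+ f t

-- a / b as a rational, with the (unused) convention x / 0 = 0
frac : ℕ → ℕ → ℚ
frac a zero = 0ℚ
frac a (suc b) = (+ a) / suc b

partialSum : (ℕ → ℕ) → ℕ → ℚ
partialSum f zero = 0ℚ
partialSum f (suc N) = partialSum f N +ℚ frac (f (suc N)) (F f (suc N))

sumℚ : List ℚ → ℚ
sumℚ [] = 0ℚ
sumℚ (x ∷ xs) = x +ℚ sumℚ xs

ind : ℕ → ℕ → ℕ
ind w a = if ⌊ w ≟ a ⌋ then 1 else 0

-- degree of w in the multigraph with edge list E (multiplicities counted,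
-- direction ignored; a loop contributes 2)
deg : List Edge → ℕ → ℕ
deg [] w = zero
deg ((a , b) ∷ E) w = ind w a ℕ.+ ind w b ℕ.+ deg E w

nodes : ℕ → List ℕ
nodes t = map suc (upTo t)

remove : ℕ → List ℕ → List ℕ
remove w = filter (λ x → ¬? (x ≟ w))

-- MPA: all sequences of k end-points chosen independently with replacement
-- from the list of candidates, each w with probability deg w / D.
seqsM : (ℕ → ℕ) → ℕ → List ℕ → ℕ → List (ℚ × List ℕ)
seqsM d D cs zero = (1ℚ , []) ∷ []
seqsM d D cs (suc k) =
  concatMap (λ w → map (λ ps → (frac (d w) D *ℚ proj₁ ps , w ∷ proj₂ ps)) (seqsM d D cs k)) cs

-- GPA: all sequences of k distinct end-points chosen successively without
-- replacement, each remaining w with probability deg w / (remaining total degree).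
seqsG : (ℕ → ℕ) → ℕ → List ℕ → ℕ → List (ℚ × List ℕ)
seqsG d D cs zero = (1ℚ , []) ∷ []
seqsG d D cs (suc k) =
  concatMap (λ w → map (λ ps → (frac (d w) D *ℚ proj₁ ps , w ∷ proj₂ ps))
                       (seqsG d (D ∸ d w) (remove w cs) k)) cs

-- The possible choices of end-points at stage t (going from G(t), edge list E,
-- to G(t+1)), with their probabilities.
choices : Model → (ℕ → ℕ) → ℕ → List Edge → List (ℚ × List ℕ)
choices MPA f t E = seqsM (deg E) (2 ℕ.* F f t) (nodes t) (f t)
choices GPA f t E = seqsG (deg E) (2 ℕ.* F f t) (nodes t) (f t)

extend : ℕ → List Edge → List ℕ → List Edge
extend t E ws = E ++ map (λ w → (suc t , w)) ws

-- Positive-probability reachable states: G(t) = E is a possible state at stage t.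
data Reachable (m : Model) (f : ℕ → ℕ) (E₀ : List Edge) : ℕ → List Edge → Set where
  start : Reachable m f E₀ 1 E₀
  step  : ∀ {t E p ws} → Reachable m f E₀ t E → (p , ws) ∈ choices m f t E →
          0ℚ <ℚ p → Reachable m f E₀ (suc t) (extend t E ws)

-- Conditional probability, given G(t) = E, that node u receives no edge during
-- the n stages t → t+1 → … → t+n.
avoid : Model → (ℕ → ℕ) → ℕ → ℕ → List Edge → ℕ → ℚ
avoid m f u t E zero = 1ℚ
avoid m f u t E (suc n) =
  sumℚ (map (λ ps → if ⌊ u ∈? proj₂ ps ⌋ then 0ℚ
                    else proj₁ ps *ℚ avoid m f u (suc t) (extend t E (proj₂ ps)) n)
            (choices m f t E))

record InitialGraph (m : Model) (v' : ℕ) (E₀ : List Edge) : Set where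
  field
    v'≥1       : 1 ≤ v'
    inRange    : ∀ {a b} → (a , b) ∈ E₀ → (1 ≤ a × a ≤ v') × (1 ≤ b × b ≤ v')
    noIsolated : ∀ u → 1 ≤ u → u ≤ v' → 1 ≤ deg E₀ u
    simpleIfGPA : m ≡ GPA → (∀ {a b} → (a , b) ∈ E₀ → a ≢ b) × Unique E₀

mkℚℕ : ℕ → ℚ
mkℚℕ B = (+ B) / 1

-- A node u of positive degree at stage t receives none of the f(t) edges of that stage with probability
-- at most (1 - 1/(2F(t)))^f(t), since its degree is at least 1 out of a total of 2F(t). Over the stages
-- t, …, t+n-1 the probability of receiving nothing is therefore at most Π_s (1 - 1/(2F(s)))^f(s), which
-- Bernoulli's inequality bounds by 1/(1 + Σ_s f(s)/(2F(s))); this tends to 0 as Σ f(s)/F(s) diverges.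

module Submission where

open import Defs
open import Data.Bool using (true; false; if_then_else_)
open import Data.Integer as ℤ using (-[1+_])
import Data.Integer.Properties as ℤ
import Data.Integer.Tactic.RingSolver as ℤ
open import Data.List using (List; []; _∷_; length; map; _++_; concatMap; filter)
import Data.List.Properties as List
open import Data.List.Membership.Propositional using (_∈_)
open import Data.List.Relation.Unary.All as All using (All; []; _∷_)
import Data.List.Relation.Unary.All.Properties as All
open import Data.List.Relation.Unary.AllPairs using ([]; _∷_)
open import Data.List.Relation.Unary.Any using (here; there)
open import Data.List.Relation.Unary.Unique.Propositional using (Unique)
import Data.List.Relation.Unary.Unique.Propositional.Properties as Unique
open import Data.Nat using (ℕ; zero; suc; z≤n; s≤s; _∸_; _⊔_)
import Data.Nat.Base as ℕ
import Data.Nat.Properties as ℕ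
import Data.Nat.Tactic.RingSolver as ℕ
open import Data.Nat.ListAction using (sum)
open import Data.Product using (_×_; _,_; proj₁; proj₂; ∃-syntax)
open import Data.Rational using (ℚ; 0ℚ; 1ℚ; mkℚ; _≤_; _<_; _+_; _*_; _-_; -_; nonNegative; toℚᵘ; *<*)
import Data.Rational.Properties as ℚ
open import Data.Rational.Unnormalised as ℚᵘ using (mkℚᵘ)
import Data.Rational.Unnormalised.Properties as ℚᵘ
open import Data.Sum using (_⊎_; inj₁; inj₂)
open import Function using (_∘_; mk⇔)
open import Relation.Binary.PropositionalEquality
  using (_≡_; _≢_; refl; sym; trans; cong; cong₂; subst; subst₂; module ≡-Reasoning)
open import Relation.Nullary using (contradiction)
open import Relation.Unary using (Decidable)
open import Relation.Nullary.Decidable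
  using (yes; no; does; ⌊_⌋; ¬?; dec⇒maybe; does-⇔; isYes≗does; dec-true)
open import Data.List.Membership.DecPropositional ℕ._≟_ using (_∈?_)
open import Algebra.Definitions.RawSemiring ℚ.+-*-rawSemiring using (_^_) renaming (_×_ to _·_)
open import Tactic.RingSolver using (solve-∀)
open import Tactic.RingSolver.Core.AlmostCommutativeRing using (AlmostCommutativeRing; fromCommutativeRing)

-- Rational arithmetic

ℚ-ring : AlmostCommutativeRing _ _
ℚ-ring = fromCommutativeRing ℚ.+-*-commutativeRing (λ x → dec⇒maybe (0ℚ ℚ.≟ x))

*-monoˡ-≤-0≤ : ∀ {r p q} → 0ℚ ≤ r → p ≤ q → r * p ≤ r * q
*-monoˡ-≤-0≤ {r} 0≤r = ℚ.*-monoˡ-≤-nonNeg r {{nonNegative 0≤r}}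

*-monoʳ-≤-0≤ : ∀ {r p q} → 0ℚ ≤ r → p ≤ q → p * r ≤ q * r
*-monoʳ-≤-0≤ {r} 0≤r = ℚ.*-monoʳ-≤-nonNeg r {{nonNegative 0≤r}}

0≤-* : ∀ {p q} → 0ℚ ≤ p → 0ℚ ≤ q → 0ℚ ≤ p * q
0≤-* {p} 0≤p 0≤q = ℚ.≤-trans (ℚ.≤-reflexive (sym (ℚ.*-zeroʳ p))) (*-monoˡ-≤-0≤ 0≤p 0≤q)

0≤-+ : ∀ {p q} → 0ℚ ≤ p → 0ℚ ≤ q → 0ℚ ≤ p + q
0≤-+ = ℚ.+-mono-≤

p+q≡r⇒p≤r : ∀ {p q r} → p + q ≡ r → 0ℚ ≤ q → p ≤ r
p+q≡r⇒p≤r {p} {q} {r} p+q≡r 0≤q = begin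
  p       ≡⟨ sym (ℚ.+-identityʳ p) ⟩
  p + 0ℚ  ≤⟨ ℚ.+-monoʳ-≤ p 0≤q ⟩
  p + q   ≡⟨ p+q≡r ⟩
  r       ∎
  where open ℚ.≤-Reasoning

x≤1⇒0≤1-x : ∀ {x} → x ≤ 1ℚ → 0ℚ ≤ 1ℚ - x
x≤1⇒0≤1-x {x} x≤1 = ℚ.≤-trans (ℚ.≤-reflexive (sym (ℚ.+-inverseʳ x))) (ℚ.+-monoˡ-≤ (- x) x≤1)

p+[q+q]≤p+[r+r]⇒q≤r : ∀ p {q r} → p + (q + q) ≤ p + (r + r) → q ≤ r
p+[q+q]≤p+[r+r]⇒q≤r p {q} {r} le with q ℚ.≤? r
... | yes q≤r = q≤r
... | no q≰r = contradiction (ℚ.<-≤-trans (ℚ.+-monoʳ-< p (ℚ.+-mono-< r<q r<q)) le) (ℚ.<-irrefl refl)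
  where r<q = ℚ.≰⇒> q≰r

-- frac a (1 + b) is by definition the normalisation of the unnormalised a / (1 + b),
-- so identities between fracs are proved in ℚᵘ.
private
  frac-toℚᵘ : ∀ a b → toℚᵘ (frac a (suc b)) ℚᵘ.≃ mkℚᵘ (ℤ.+ a) b
  frac-toℚᵘ a b = ℚ.toℚᵘ-fromℚᵘ (mkℚᵘ (ℤ.+ a) b)

frac-0 : ∀ D → frac 0 D ≡ 0ℚ
frac-0 zero    = refl
frac-0 (suc b) = ℚ.0/n≡0 (suc b)

frac-+ : ∀ a c D → frac a D + frac c D ≡ frac (a ℕ.+ c) D
frac-+ a c zero    = ℚ.+-identityˡ 0ℚ
frac-+ a c (suc b) = ℚ.toℚᵘ-injective (begin
  toℚᵘ (frac a (suc b) + frac c (suc b))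
    ≈⟨ ℚ.toℚᵘ-homo-+ (frac a (suc b)) (frac c (suc b)) ⟩
  toℚᵘ (frac a (suc b)) ℚᵘ.+ toℚᵘ (frac c (suc b))
    ≈⟨ ℚᵘ.+-cong (frac-toℚᵘ a b) (frac-toℚᵘ c b) ⟩
  mkℚᵘ (ℤ.+ a) b ℚᵘ.+ mkℚᵘ (ℤ.+ c) b
    ≈⟨ ℚᵘ.*≡* common-denominator ⟩
  mkℚᵘ (ℤ.+ (a ℕ.+ c)) b
    ≈⟨ frac-toℚᵘ (a ℕ.+ c) b ⟨
  toℚᵘ (frac (a ℕ.+ c) (suc b))
    ∎)
  where
  open ℚᵘ.≃-Reasoning
  distrib : ∀ (A C S : ℤ.ℤ) → (A ℤ.* S ℤ.+ C ℤ.* S) ℤ.* S ≡ (A ℤ.+ C) ℤ.* (S ℤ.* S)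
  distrib = ℤ.solve-∀
  common-denominator = trans (distrib (ℤ.+ a) (ℤ.+ c) (ℤ.+ suc b))
    (cong₂ ℤ._*_ (sym (ℤ.pos-+ a c)) (sym (ℤ.pos-* (suc b) (suc b))))

frac-* : ∀ a b c d → frac a (suc b) * frac c (suc d) ≡ frac (a ℕ.* c) (suc b ℕ.* suc d)
frac-* a b c d = ℚ.toℚᵘ-injective (begin
  toℚᵘ (frac a (suc b) * frac c (suc d))
    ≈⟨ ℚ.toℚᵘ-homo-* (frac a (suc b)) (frac c (suc d)) ⟩
  toℚᵘ (frac a (suc b)) ℚᵘ.* toℚᵘ (frac c (suc d))
    ≈⟨ ℚᵘ.*-cong (frac-toℚᵘ a b) (frac-toℚᵘ c d) ⟩
  mkℚᵘ (ℤ.+ a) b ℚᵘ.* mkℚᵘ (ℤ.+ c) d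
    ≈⟨ ℚᵘ.*≡* (cong (ℤ._* ℤ.+ suc e) (sym (ℤ.pos-* a c))) ⟩
  mkℚᵘ (ℤ.+ (a ℕ.* c)) e
    ≈⟨ frac-toℚᵘ (a ℕ.* c) e ⟨
  toℚᵘ (frac (a ℕ.* c) (suc b ℕ.* suc d))
    ∎)
  where
  open ℚᵘ.≃-Reasoning
  e = d ℕ.+ b ℕ.* suc d

frac-≤ : ∀ {a b c d} → a ℕ.* suc d ℕ.≤ c ℕ.* suc b → frac a (suc b) ≤ frac c (suc d)
frac-≤ {a} {b} {c} {d} ad≤cb = ℚ.toℚᵘ-cancel-≤
  (ℚᵘ.≤-respˡ-≃ (ℚᵘ.≃-sym (frac-toℚᵘ a b)) (ℚᵘ.≤-respʳ-≃ (ℚᵘ.≃-sym (frac-toℚᵘ c d))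
    (ℚᵘ.*≤* (subst₂ ℤ._≤_ (ℤ.pos-* a (suc d)) (ℤ.pos-* c (suc b)) (ℤ.+≤+ ad≤cb)))))

frac-cong : ∀ {a b c d} → a ℕ.* suc d ≡ c ℕ.* suc b → frac a (suc b) ≡ frac c (suc d)
frac-cong {a} {b} {c} {d} ad≡cb =
  ℚ.≤-antisym (frac-≤ {a} {b} {c} {d} (ℕ.≤-reflexive ad≡cb))
              (frac-≤ {c} {d} {a} {b} (ℕ.≤-reflexive (sym ad≡cb)))

frac-1-*-inverse : ∀ K → frac 1 (suc K) * mkℚℕ (suc K) ≡ 1ℚ
frac-1-*-inverse K = trans (frac-* 1 K (suc K) 0) (frac-cong {1 ℕ.* suc K} {K ℕ.* 1} {1} {0} (ℕ.*-assoc 1 (suc K) 1))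

0≤-frac : ∀ a D → 0ℚ ≤ frac a D
0≤-frac a zero    = ℚ.≤-refl
0≤-frac a (suc b) = subst (_≤ frac a (suc b)) (frac-0 (suc b)) (frac-≤ {0} {b} {a} {b} z≤n)

frac-≤-1 : ∀ a D → a ℕ.≤ D → frac a D ≤ 1ℚ
frac-≤-1 a zero    _   = 0≤-frac 1 1
frac-≤-1 a (suc b) a≤D =
  frac-≤ {a} {b} {1} {0} (subst₂ ℕ._≤_ (sym (ℕ.*-identityʳ a)) (sym (ℕ.*-identityˡ (suc b))) a≤D)

frac-1-≤-1 : ∀ D → frac 1 D ≤ 1ℚ
frac-1-≤-1 zero    = 0≤-frac 1 1
frac-1-≤-1 (suc b) = frac-≤-1 1 (suc b) (s≤s z≤n)

frac-≤-mkℚℕ : ∀ a D → frac a D ≤ mkℚℕ a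
frac-≤-mkℚℕ a zero    = 0≤-frac a 1
frac-≤-mkℚℕ a (suc b) =
  frac-≤ {a} {b} {a} {0} (subst (ℕ._≤ a ℕ.* suc b) (sym (ℕ.*-identityʳ a)) (ℕ.m≤m*n a (suc b)))

frac-≤-1-frac-1 : ∀ a D → suc a ℕ.≤ D → frac a D ≤ 1ℚ - frac 1 D
frac-≤-1-frac-1 a D a<D = begin
  frac a D                            ≡⟨ move (frac a D) (frac 1 D) ⟩
  frac a D + frac 1 D - frac 1 D      ≡⟨ cong (_- frac 1 D) (frac-+ a 1 D) ⟩
  frac (a ℕ.+ 1) D - frac 1 D
    ≤⟨ ℚ.+-monoˡ-≤ (- frac 1 D) (frac-≤-1 (a ℕ.+ 1) D (subst (ℕ._≤ D) (ℕ.+-comm 1 a) a<D)) ⟩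
  1ℚ - frac 1 D                       ∎
  where
  open ℚ.≤-Reasoning
  move : ∀ p q → p ≡ p + q - q
  move = solve-∀ ℚ-ring

0≤-1-frac-1 : ∀ D → 0ℚ ≤ 1ℚ - frac 1 D
0≤-1-frac-1 D = x≤1⇒0≤1-x (frac-1-≤-1 D)

1-frac-1-mono : ∀ {A B} → 1 ℕ.≤ A → A ℕ.≤ B → 1ℚ - frac 1 A ≤ 1ℚ - frac 1 B
1-frac-1-mono {suc a} {suc b} _ A≤B =
  ℚ.+-monoʳ-≤ 1ℚ (ℚ.neg-antimono-≤ (frac-≤ {1} {b} {1} {a} (ℕ.+-monoˡ-≤ 0 A≤B)))

frac-≤-halves : ∀ a D → frac a D ≤ frac a (2 ℕ.* D) + frac a (2 ℕ.* D)
frac-≤-halves a zero    = ℚ.≤-reflexive (sym (ℚ.+-identityʳ 0ℚ))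
frac-≤-halves a (suc b) = ℚ.≤-reflexive (begin
  frac a (suc b)                               ≡⟨ frac-cong {a} {b} {a ℕ.+ a} {b ℕ.+ suc (b ℕ.+ 0)} (twice a (suc b)) ⟩
  frac (a ℕ.+ a) (2 ℕ.* suc b)                 ≡⟨ frac-+ a a (2 ℕ.* suc b) ⟨
  frac a (2 ℕ.* suc b) + frac a (2 ℕ.* suc b)  ∎)
  where
  open ≡-Reasoning
  twice : ∀ a b → a ℕ.* (2 ℕ.* b) ≡ (a ℕ.+ a) ℕ.* b
  twice = ℕ.solve-∀

·-frac-1 : ∀ k D → k · frac 1 D ≡ frac k D
·-frac-1 zero    D = sym (frac-0 D)
·-frac-1 (suc k) D = trans (cong (frac 1 D +_) (·-frac-1 k D)) (frac-+ 1 k D)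

unit-fraction-≤ : ∀ ε → 0ℚ < ε → ∃[ K ] frac 1 (suc K) ≤ ε
unit-fraction-≤ ε@(mkℚ (ℤ.+ suc n) K _) _ =
  K , subst (frac 1 (suc K) ≤_) (ℚ.↥p/↧p≡p ε)
            (frac-≤ {1} {K} {suc n} {K} (ℕ.*-monoˡ-≤ (suc K) {1} {suc n} (s≤s z≤n)))
unit-fraction-≤ ε@(mkℚ (ℤ.+ zero) K _) 0<ε =
  contradiction 0<ε (ℚ.<-irrefl (trans (sym (frac-0 (suc K))) (ℚ.↥p/↧p≡p ε)))
unit-fraction-≤ (mkℚ -[1+ n ] K _) (*<* ())

0≤-^ : ∀ {x} k → 0ℚ ≤ x → 0ℚ ≤ x ^ k
0≤-^ zero    _   = 0≤-frac 1 1
0≤-^ (suc k) 0≤x = 0≤-* 0≤x (0≤-^ k 0≤x)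

^-monoˡ-≤ : ∀ {x y} k → 0ℚ ≤ x → x ≤ y → x ^ k ≤ y ^ k
^-monoˡ-≤ zero    _   _   = ℚ.≤-refl
^-monoˡ-≤ (suc k) 0≤x x≤y = ℚ.≤-trans (*-monoˡ-≤-0≤ 0≤x (^-monoˡ-≤ k 0≤x x≤y))
                                      (*-monoʳ-≤-0≤ (0≤-^ k (ℚ.≤-trans 0≤x x≤y)) x≤y)

0≤-· : ∀ k {x} → 0ℚ ≤ x → 0ℚ ≤ k · x
0≤-· zero    _   = ℚ.≤-refl
0≤-· (suc k) 0≤x = 0≤-+ 0≤x (0≤-· k 0≤x)

bernoulli : ∀ {x} → 0ℚ ≤ x → x ≤ 1ℚ → ∀ k → (1ℚ - x) ^ k * (1ℚ + k · x) ≤ 1ℚ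
bernoulli 0≤x x≤1 zero    = ℚ.≤-reflexive (trans (ℚ.*-identityˡ _) (ℚ.+-identityʳ 1ℚ))
bernoulli {x} 0≤x x≤1 (suc k) = begin
  (1ℚ - x) ^ suc k * (1ℚ + suc k · x)  ≤⟨ p+q≡r⇒p≤r (expand x ((1ℚ - x) ^ k) (k · x)) surplus ⟩
  (1ℚ - x) ^ k * (1ℚ + k · x)          ≤⟨ bernoulli 0≤x x≤1 k ⟩
  1ℚ                                   ∎
  where
  open ℚ.≤-Reasoning
  expand : ∀ x P y → (1ℚ - x) * P * (1ℚ + (x + y)) + P * (x * (x + y)) ≡ P * (1ℚ + y)
  expand = solve-∀ ℚ-ring
  surplus = 0≤-* (0≤-^ k (x≤1⇒0≤1-x x≤1)) (0≤-* 0≤x (0≤-+ 0≤x (0≤-· k 0≤x)))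

-- Degree sums

degExcept : (ℕ → ℕ) → ℕ → ℕ → ℕ
degExcept d u w = if ⌊ u ℕ.≟ w ⌋ then 0 else d w

candidateMass : (ℕ → ℕ) → ℕ → List ℕ → ℕ
candidateMass d u cs = d u ℕ.+ sum (map (degExcept d u) cs)

degExcept-≢ : ∀ d {u w} → u ≢ w → degExcept d u w ≡ d w
degExcept-≢ d {u} {w} u≢w with u ℕ.≟ w
... | yes u≡w = contradiction u≡w u≢w
... | no _    = refl

sum-map-filter-≤ : ∀ {A : Set} (a : A → ℕ) {P : A → Set} (P? : Decidable P) xs →
  sum (map a (filter P? xs)) ℕ.≤ sum (map a xs)
sum-map-filter-≤ a P? []       = z≤n
sum-map-filter-≤ a P? (x ∷ xs) with does (P? x)
... | true  = ℕ.+-monoʳ-≤ (a x) (sum-map-filter-≤ a P? xs)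
... | false = ℕ.≤-trans (sum-map-filter-≤ a P? xs) (ℕ.m≤n+m _ (a x))

sum-map-remove-≤ : ∀ (a : ℕ → ℕ) {w} xs → w ∈ xs →
  a w ℕ.+ sum (map a (remove w xs)) ℕ.≤ sum (map a xs)
sum-map-remove-≤ a {w} (x ∷ xs) w∈ with x ℕ.≟ w | w∈
... | yes refl | _ rewrite List.filter-reject (λ y → ¬? (y ℕ.≟ x)) {x} {xs} (λ x≢x → x≢x refl) =
  ℕ.+-monoʳ-≤ (a x) (sum-map-filter-≤ a (λ y → ¬? (y ℕ.≟ x)) xs)
... | no x≢w | here w≡x = contradiction (sym w≡x) x≢w
... | no x≢w | there w∈xs rewrite List.filter-accept (λ y → ¬? (y ℕ.≟ w)) {x} {xs} x≢w =
  ℕ.≤-trans (ℕ.≤-reflexive (swap (a w) (a x) _)) (ℕ.+-monoʳ-≤ (a x) (sum-map-remove-≤ a xs w∈xs))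
  where
  swap : ∀ p q r → p ℕ.+ (q ℕ.+ r) ≡ q ℕ.+ (p ℕ.+ r)
  swap = ℕ.solve-∀

candidateMass-remove : ∀ {d D u w} cs → w ∈ cs → u ≢ w →
  candidateMass d u cs ℕ.≤ D → candidateMass d u (remove w cs) ℕ.≤ D ∸ d w
candidateMass-remove {d} {D} {u} {w} cs w∈cs u≢w mass≤D = ℕ.m+n≤o⇒m≤o∸n (d u ℕ.+ rest) (begin
  d u ℕ.+ rest ℕ.+ d w                ≡⟨ rearrange (d u) rest (d w) ⟩
  d u ℕ.+ (d w ℕ.+ rest)              ≡⟨ cong (λ x → d u ℕ.+ (x ℕ.+ rest)) (degExcept-≢ d u≢w) ⟨
  d u ℕ.+ (degExcept d u w ℕ.+ rest)  ≤⟨ ℕ.+-monoʳ-≤ (d u) (sum-map-remove-≤ (degExcept d u) cs w∈cs) ⟩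
  d u ℕ.+ sum (map (degExcept d u) cs) ≤⟨ mass≤D ⟩
  D                                   ∎)
  where
  open ℕ.≤-Reasoning
  rest = sum (map (degExcept d u) (remove w cs))
  rearrange : ∀ p q r → p ℕ.+ q ℕ.+ r ≡ p ℕ.+ (r ℕ.+ q)
  rearrange = ℕ.solve-∀

ind-self : ∀ a → ind a a ≡ 1
ind-self a with a ℕ.≟ a
... | yes _   = refl
... | no a≢a = contradiction refl a≢a

ind-≢ : ∀ {w a} → w ≢ a → ind w a ≡ 0
ind-≢ {w} {a} w≢a with w ℕ.≟ a
... | yes w≡a = contradiction w≡a w≢a
... | no _    = refl

ind-≤1 : ∀ w a → ind w a ℕ.≤ 1
ind-≤1 w a with w ℕ.≟ a
... | yes _ = ℕ.≤-refl
... | no _  = z≤n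

sum-degExcept-+ : ∀ (g h : ℕ → ℕ) u cs →
  sum (map (degExcept (λ x → g x ℕ.+ h x) u) cs) ≡ sum (map (degExcept g u) cs) ℕ.+ sum (map (degExcept h u) cs)
sum-degExcept-+ g h u []       = refl
sum-degExcept-+ g h u (w ∷ cs) with u ℕ.≟ w
... | yes _ = sum-degExcept-+ g h u cs
... | no _  = trans (cong (g w ℕ.+ h w ℕ.+_) (sum-degExcept-+ g h u cs)) (interchange (g w) (h w) _ _)
  where
  interchange : ∀ a b c d → a ℕ.+ b ℕ.+ (c ℕ.+ d) ≡ a ℕ.+ c ℕ.+ (b ℕ.+ d)
  interchange = ℕ.solve-∀

sum-degExcept-0 : ∀ d u {cs} → All (λ w → d w ≡ 0) cs → sum (map (degExcept d u) cs) ≡ 0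
sum-degExcept-0 d u []                       = refl
sum-degExcept-0 d u {w ∷ cs} (dw≡0 ∷ d[cs]≡0) with u ℕ.≟ w
... | yes _ = sum-degExcept-0 d u d[cs]≡0
... | no _  = cong₂ ℕ._+_ dw≡0 (sum-degExcept-0 d u d[cs]≡0)

candidateMass-ind-≤1 : ∀ u a cs → Unique cs → candidateMass (λ x → ind x a) u cs ℕ.≤ 1
candidateMass-ind-≤1 u a []       []           =
  ℕ.≤-trans (ℕ.≤-reflexive (ℕ.+-identityʳ (ind u a))) (ind-≤1 u a)
candidateMass-ind-≤1 u a (x ∷ xs) (x∉xs ∷ uq) with u ℕ.≟ x | x ℕ.≟ a
... | yes _  | _     = candidateMass-ind-≤1 u a xs uq
... | no _   | no _  = candidateMass-ind-≤1 u a xs uq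
... | no u≢x | yes refl rewrite ind-≢ u≢x =
  ℕ.≤-reflexive (cong suc (sum-degExcept-0 (λ y → ind y x) u
                             (All.map (λ x≢y → ind-≢ (x≢y ∘ sym)) x∉xs)))

candidateMass-≤ : ∀ E u cs → Unique cs → candidateMass (deg E) u cs ℕ.≤ 2 ℕ.* length E
candidateMass-≤ []            u cs _  = ℕ.≤-reflexive (sum-degExcept-0 (deg []) u (All.universal (λ _ → refl) cs))
candidateMass-≤ ((a , b) ∷ E) u cs uq = begin
  ind u a ℕ.+ ind u b ℕ.+ deg E u ℕ.+ sum (map (degExcept (deg ((a , b) ∷ E)) u) cs)
    ≡⟨ cong (ind u a ℕ.+ ind u b ℕ.+ deg E u ℕ.+_) split ⟩
  ind u a ℕ.+ ind u b ℕ.+ deg E u ℕ.+ (Sa ℕ.+ Sb ℕ.+ SE)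
    ≡⟨ regroup (ind u a) (ind u b) (deg E u) Sa Sb SE ⟩
  (ind u a ℕ.+ Sa) ℕ.+ (ind u b ℕ.+ Sb) ℕ.+ (deg E u ℕ.+ SE)
    ≤⟨ ℕ.+-mono-≤ (ℕ.+-mono-≤ (candidateMass-ind-≤1 u a cs uq) (candidateMass-ind-≤1 u b cs uq))
                  (candidateMass-≤ E u cs uq) ⟩
  1 ℕ.+ 1 ℕ.+ 2 ℕ.* length E
    ≡⟨ two-more (length E) ⟩
  2 ℕ.* length ((a , b) ∷ E)
    ∎
  where
  open ℕ.≤-Reasoning
  Sa = sum (map (degExcept (λ x → ind x a) u) cs)
  Sb = sum (map (degExcept (λ x → ind x b) u) cs)
  SE = sum (map (degExcept (deg E) u) cs)
  split : sum (map (degExcept (deg ((a , b) ∷ E)) u) cs) ≡ Sa ℕ.+ Sb ℕ.+ SE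
  split = trans (sum-degExcept-+ (λ x → ind x a ℕ.+ ind x b) (deg E) u cs)
                (cong (ℕ._+ SE) (sum-degExcept-+ (λ x → ind x a) (λ x → ind x b) u cs))
  regroup : ∀ ia ib dE sa sb sE →
    ia ℕ.+ ib ℕ.+ dE ℕ.+ (sa ℕ.+ sb ℕ.+ sE) ≡ (ia ℕ.+ sa) ℕ.+ (ib ℕ.+ sb) ℕ.+ (dE ℕ.+ sE)
  regroup = ℕ.solve-∀
  two-more : ∀ n → 1 ℕ.+ 1 ℕ.+ 2 ℕ.* n ≡ 2 ℕ.* suc n
  two-more = ℕ.solve-∀

nodes-unique : ∀ t → Unique (nodes t)
nodes-unique t = Unique.map⁺ ℕ.suc-injective (Unique.upTo⁺ t)

candidateMass-nodes-≤ : ∀ f t E u → length E ≡ F f t → candidateMass (deg E) u (nodes t) ℕ.≤ 2 ℕ.* F f t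
candidateMass-nodes-≤ f t E u size =
  subst (λ n → candidateMass (deg E) u (nodes t) ℕ.≤ 2 ℕ.* n) size
        (candidateMass-≤ E u (nodes t) (nodes-unique t))

-- One stage of the process

avoiding : ℕ → (List ℕ → ℚ) → ℚ × List ℕ → ℚ
avoiding u φ ps = if ⌊ u ∈? proj₂ ps ⌋ then 0ℚ else proj₁ ps * φ (proj₂ ps)

-- avoid m f u t E (suc n) unfolds to
-- escape u (λ ws → avoid m f u (suc t) (extend t E ws) n) (choices m f t E).
escape : ℕ → (List ℕ → ℚ) → List (ℚ × List ℕ) → ℚ
escape u φ L = sumℚ (map (avoiding u φ) L)

prepend : (ℕ → ℕ) → ℕ → ℕ → ℚ × List ℕ → ℚ × List ℕ
prepend d D w ps = (frac (d w) D * proj₁ ps , w ∷ proj₂ ps)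

∈?-∷-self : ∀ u ws → ⌊ u ∈? (u ∷ ws) ⌋ ≡ true
∈?-∷-self u ws = trans (isYes≗does (u ∈? u ∷ ws)) (dec-true (u ∈? u ∷ ws) (here refl))

∈?-∷-≢ : ∀ {u w} ws → u ≢ w → ⌊ u ∈? (w ∷ ws) ⌋ ≡ ⌊ u ∈? ws ⌋
∈?-∷-≢ {u} {w} ws u≢w = trans (isYes≗does (u ∈? w ∷ ws))
  (trans (does-⇔ (mk⇔ drop-head there) (u ∈? w ∷ ws) (u ∈? ws)) (sym (isYes≗does (u ∈? ws))))
  where
  drop-head : u ∈ w ∷ ws → u ∈ ws
  drop-head (here u≡w)   = contradiction u≡w u≢w
  drop-head (there u∈ws) = u∈ws

escape-++ : ∀ u φ L L′ → escape u φ (L ++ L′) ≡ escape u φ L + escape u φ L′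
escape-++ u φ []       L′ = sym (ℚ.+-identityˡ _)
escape-++ u φ (ps ∷ L) L′ =
  trans (cong (avoiding u φ ps +_) (escape-++ u φ L L′))
        (sym (ℚ.+-assoc (avoiding u φ ps) (escape u φ L) (escape u φ L′)))

escape-prepend-self : ∀ d D u φ L → escape u φ (map (prepend d D u) L) ≡ 0ℚ
escape-prepend-self d D u φ []             = refl
escape-prepend-self d D u φ ((p , ws) ∷ L) rewrite ∈?-∷-self u ws =
  trans (ℚ.+-identityˡ _) (escape-prepend-self d D u φ L)

escape-prepend-≢ : ∀ d D {u w} φ L → u ≢ w →
  escape u φ (map (prepend d D w) L) ≡ frac (d w) D * escape u (φ ∘ (w ∷_)) L
escape-prepend-≢ d D φ [] _ = sym (ℚ.*-zeroʳ (frac _ D))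
escape-prepend-≢ d D {u} {w} φ ((p , ws) ∷ L) u≢w = begin
  avoiding u φ (prepend d D w (p , ws)) + escape u φ (map (prepend d D w) L)
    ≡⟨ cong₂ _+_ head (escape-prepend-≢ d D φ L u≢w) ⟩
  c * avoiding u (φ ∘ (w ∷_)) (p , ws) + c * escape u (φ ∘ (w ∷_)) L
    ≡⟨ ℚ.*-distribˡ-+ c _ _ ⟨
  c * escape u (φ ∘ (w ∷_)) ((p , ws) ∷ L)
    ∎
  where
  open ≡-Reasoning
  c = frac (d w) D
  head : avoiding u φ (prepend d D w (p , ws)) ≡ c * avoiding u (φ ∘ (w ∷_)) (p , ws)
  head rewrite ∈?-∷-≢ ws u≢w with ⌊ u ∈? ws ⌋
  ... | true  = sym (ℚ.*-zeroʳ c)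
  ... | false = ℚ.*-assoc c p (φ (w ∷ ws))

escape-branch-≤ : ∀ d D u w φ L {X} → 0ℚ ≤ X → (u ≢ w → escape u (φ ∘ (w ∷_)) L ≤ X) →
  escape u φ (map (prepend d D w) L) ≤ frac (degExcept d u w) D * X
escape-branch-≤ d D u w φ L {X} 0≤X bound with u ℕ.≟ w
... | yes refl = ℚ.≤-reflexive (begin
  escape u φ (map (prepend d D u) L) ≡⟨ escape-prepend-self d D u φ L ⟩
  0ℚ                                 ≡⟨ ℚ.*-zeroˡ X ⟨
  0ℚ * X                             ≡⟨ cong (_* X) (frac-0 D) ⟨
  frac 0 D * X                       ∎)
  where open ≡-Reasoning
... | no u≢w = begin
  escape u φ (map (prepend d D w) L)       ≡⟨ escape-prepend-≢ d D φ L u≢w ⟩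
  frac (d w) D * escape u (φ ∘ (w ∷_)) L  ≤⟨ *-monoˡ-≤-0≤ (0≤-frac (d w) D) (bound u≢w) ⟩
  frac (d w) D * X                         ∎
  where open ℚ.≤-Reasoning

escape-branches-≤ : ∀ d D u φ (L : ℕ → List (ℚ × List ℕ)) {X} cs → 0ℚ ≤ X →
  (∀ w → w ∈ cs → u ≢ w → escape u (φ ∘ (w ∷_)) (L w) ≤ X) →
  escape u φ (concatMap (λ w → map (prepend d D w) (L w)) cs) ≤ frac (sum (map (degExcept d u) cs)) D * X
escape-branches-≤ d D u φ L {X} [] _ _ = ℚ.≤-reflexive (sym (trans (cong (_* X) (frac-0 D)) (ℚ.*-zeroˡ X)))
escape-branches-≤ d D u φ L {X} (w ∷ cs) 0≤X bound = begin
  escape u φ (branch w ++ concatMap branch cs)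
    ≡⟨ escape-++ u φ (branch w) (concatMap branch cs) ⟩
  escape u φ (branch w) + escape u φ (concatMap branch cs)
    ≤⟨ ℚ.+-mono-≤ (escape-branch-≤ d D u w φ (L w) 0≤X (bound w (here refl)))
                  (escape-branches-≤ d D u φ L cs 0≤X (λ w′ w′∈cs → bound w′ (there w′∈cs))) ⟩
  frac a D * X + frac s D * X
    ≡⟨ ℚ.*-distribʳ-+ X (frac a D) (frac s D) ⟨
  (frac a D + frac s D) * X
    ≡⟨ cong (_* X) (frac-+ a s D) ⟩
  frac (sum (map (degExcept d u) (w ∷ cs))) D * X
    ∎
  where
  open ℚ.≤-Reasoning
  branch = λ w → map (prepend d D w) (L w)
  a = degExcept d u w
  s = sum (map (degExcept d u) cs)

-- Every end-point is drawn proportionally to degree from a total of at most D,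
-- of which u holds at least 1, so it misses u with probability at most 1 - 1/D.
escape-stage-≤ : ∀ d D u φ (L : ℕ → List (ℚ × List ℕ)) {X} cs →
  1 ℕ.≤ d u → candidateMass d u cs ℕ.≤ D → 0ℚ ≤ X →
  (∀ w → w ∈ cs → u ≢ w → escape u (φ ∘ (w ∷_)) (L w) ≤ X) →
  escape u φ (concatMap (λ w → map (prepend d D w) (L w)) cs) ≤ (1ℚ - frac 1 D) * X
escape-stage-≤ d D u φ L cs 1≤du mass≤D 0≤X bound =
  ℚ.≤-trans (escape-branches-≤ d D u φ L cs 0≤X bound)
            (*-monoʳ-≤-0≤ 0≤X (frac-≤-1-frac-1 others D (ℕ.≤-trans (ℕ.+-monoˡ-≤ others 1≤du) mass≤D)))
  where others = sum (map (degExcept d u) cs)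

escape-unit-≤ : ∀ u {φ G} → φ [] ≤ G → escape u φ ((1ℚ , []) ∷ []) ≤ 1ℚ * G
escape-unit-≤ u {φ} φ[]≤G =
  ℚ.≤-trans (ℚ.≤-reflexive (ℚ.+-identityʳ (1ℚ * φ []))) (*-monoˡ-≤-0≤ (0≤-frac 1 1) φ[]≤G)

escape-seqsM-≤ : ∀ {d D u} cs → 1 ℕ.≤ d u → candidateMass d u cs ℕ.≤ D →
  ∀ k {φ G} → 0ℚ ≤ G → (∀ ws → length ws ≡ k → φ ws ≤ G) →
  escape u φ (seqsM d D cs k) ≤ (1ℚ - frac 1 D) ^ k * G
escape-seqsM-≤ {u = u} cs _ _ zero {φ} _ φ≤G = escape-unit-≤ u {φ} (φ≤G [] refl)
escape-seqsM-≤ {d} {D} {u} cs 1≤du mass≤D (suc k) {φ} {G} 0≤G φ≤G = begin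
  escape u φ (seqsM d D cs (suc k))
    ≤⟨ escape-stage-≤ d D u φ (λ _ → seqsM d D cs k) cs 1≤du mass≤D
         (0≤-* (0≤-^ k (0≤-1-frac-1 D)) 0≤G)
         (λ w _ _ → escape-seqsM-≤ cs 1≤du mass≤D k 0≤G (λ ws len → φ≤G (w ∷ ws) (cong suc len))) ⟩
  (1ℚ - frac 1 D) * ((1ℚ - frac 1 D) ^ k * G)
    ≡⟨ ℚ.*-assoc (1ℚ - frac 1 D) ((1ℚ - frac 1 D) ^ k) G ⟨
  (1ℚ - frac 1 D) ^ suc k * G
    ∎
  where open ℚ.≤-Reasoning

escape-seqsG-≤ : ∀ {d u} → 1 ℕ.≤ d u → ∀ k {D} cs → candidateMass d u cs ℕ.≤ D →
  ∀ {φ G} → 0ℚ ≤ G → (∀ ws → length ws ≡ k → φ ws ≤ G) →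
  escape u φ (seqsG d D cs k) ≤ (1ℚ - frac 1 D) ^ k * G
escape-seqsG-≤ {u = u} _ zero _ _ {φ} _ φ≤G = escape-unit-≤ u {φ} (φ≤G [] refl)
escape-seqsG-≤ {d} {u} 1≤du (suc k) {D} cs mass≤D {φ} {G} 0≤G φ≤G = begin
  escape u φ (seqsG d D cs (suc k))
    ≤⟨ escape-stage-≤ d D u φ (λ w → seqsG d (D ∸ d w) (remove w cs) k) cs 1≤du mass≤D
         (0≤-* (0≤-^ k (0≤-1-frac-1 D)) 0≤G) branch ⟩
  (1ℚ - frac 1 D) * ((1ℚ - frac 1 D) ^ k * G)
    ≡⟨ ℚ.*-assoc (1ℚ - frac 1 D) ((1ℚ - frac 1 D) ^ k) G ⟨
  (1ℚ - frac 1 D) ^ suc k * G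
    ∎
  where
  open ℚ.≤-Reasoning
  -- Without replacement the remaining total D ∸ d w is smaller, and 1 - 1/x grows with x.
  branch : ∀ w → w ∈ cs → u ≢ w →
    escape u (φ ∘ (w ∷_)) (seqsG d (D ∸ d w) (remove w cs) k) ≤ (1ℚ - frac 1 D) ^ k * G
  branch w w∈cs u≢w = begin
    escape u (φ ∘ (w ∷_)) (seqsG d (D ∸ d w) (remove w cs) k)
      ≤⟨ escape-seqsG-≤ 1≤du k (remove w cs) mass′≤ 0≤G (λ ws len → φ≤G (w ∷ ws) (cong suc len)) ⟩
    (1ℚ - frac 1 (D ∸ d w)) ^ k * G
      ≤⟨ *-monoʳ-≤-0≤ 0≤G (^-monoˡ-≤ k (0≤-1-frac-1 (D ∸ d w))
                                       (1-frac-1-mono 1≤D∸dw (ℕ.m∸n≤m D (d w)))) ⟩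
    (1ℚ - frac 1 D) ^ k * G
      ∎
    where
    mass′≤ = candidateMass-remove cs w∈cs u≢w mass≤D
    1≤D∸dw = ℕ.≤-trans 1≤du (ℕ.≤-trans (ℕ.m≤m+n (d u) _) mass′≤)

escape-choices-≤ : ∀ m f t E {u φ G} → length E ≡ F f t → 1 ℕ.≤ deg E u → 0ℚ ≤ G →
  (∀ ws → length ws ≡ f t → φ ws ≤ G) →
  escape u φ (choices m f t E) ≤ (1ℚ - frac 1 (2 ℕ.* F f t)) ^ f t * G
escape-choices-≤ MPA f t E {u} size 1≤du =
  escape-seqsM-≤ (nodes t) 1≤du (candidateMass-nodes-≤ f t E u size) (f t)
escape-choices-≤ GPA f t E {u} size 1≤du =
  escape-seqsG-≤ 1≤du (f t) (nodes t) (candidateMass-nodes-≤ f t E u size)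

-- Reachable states

seqsM-lengths : ∀ d D cs k → All (λ ps → length (proj₂ ps) ≡ k) (seqsM d D cs k)
seqsM-lengths d D cs zero    = refl ∷ []
seqsM-lengths d D cs (suc k) =
  All.concat⁺ (All.map⁺ (All.universal (λ w → All.map⁺ (All.map (cong suc) (seqsM-lengths d D cs k))) cs))

seqsG-lengths : ∀ d D cs k → All (λ ps → length (proj₂ ps) ≡ k) (seqsG d D cs k)
seqsG-lengths d D cs zero    = refl ∷ []
seqsG-lengths d D cs (suc k) = All.concat⁺ (All.map⁺ (All.universal
  (λ w → All.map⁺ (All.map (cong suc) (seqsG-lengths d (D ∸ d w) (remove w cs) k))) cs))

choices-length : ∀ m f t E {p ws} → (p , ws) ∈ choices m f t E → length ws ≡ f t
choices-length MPA f t E = All.lookup (seqsM-lengths _ _ _ (f t))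
choices-length GPA f t E = All.lookup (seqsG-lengths _ _ _ (f t))

deg-++ : ∀ E E′ w → deg (E ++ E′) w ≡ deg E w ℕ.+ deg E′ w
deg-++ []            E′ w = refl
deg-++ ((a , b) ∷ E) E′ w =
  trans (cong (ind w a ℕ.+ ind w b ℕ.+_) (deg-++ E E′ w))
        (sym (ℕ.+-assoc (ind w a ℕ.+ ind w b) (deg E w) (deg E′ w)))

length-≤-deg-star : ∀ a ws → length ws ℕ.≤ deg (map (λ w → (a , w)) ws) a
length-≤-deg-star a []       = z≤n
length-≤-deg-star a (w ∷ ws) rewrite ind-self a =
  s≤s (ℕ.≤-trans (length-≤-deg-star a ws) (ℕ.m≤n+m _ (ind a w)))

length-extend : ∀ t E ws → length (extend t E ws) ≡ length E ℕ.+ length ws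
length-extend t E ws = trans (List.length-++ E) (cong (length E ℕ.+_) (List.length-map _ ws))

deg-≤-extend : ∀ t E ws w → deg E w ℕ.≤ deg (extend t E ws) w
deg-≤-extend t E ws w = ℕ.≤-trans (ℕ.m≤m+n (deg E w) _) (ℕ.≤-reflexive (sym (deg-++ E _ w)))

reachable-size : ∀ {m f E₀ t E} → f 0 ≡ length E₀ → Reachable m f E₀ t E → length E ≡ F f t
reachable-size f0≡e′ start = sym f0≡e′
reachable-size {m} {f} f0≡e′ (step {t} {E} {ws = ws} reach ws∈choices _) =
  trans (length-extend t E ws) (cong₂ ℕ._+_ (reachable-size f0≡e′ reach) (choices-length m f t E ws∈choices))

≤-suc-⊔ : ∀ {u t} v′ → u ℕ.≤ suc t ⊔ v′ → u ℕ.≤ t ⊔ v′ ⊎ (u ≡ suc t × v′ ℕ.≤ t)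
≤-suc-⊔ {u} {t} v′ u≤ with v′ ℕ.≤? t
... | no v′≰t =
  inj₁ (ℕ.≤-trans (subst (u ℕ.≤_) (ℕ.m≤n⇒m⊔n≡n (ℕ.≰⇒> v′≰t)) u≤) (ℕ.m≤n⊔m t v′))
... | yes v′≤t with ℕ.m≤n⇒m<n∨m≡n (subst (u ℕ.≤_) (ℕ.m≥n⇒m⊔n≡m (ℕ.m≤n⇒m≤1+n v′≤t)) u≤)
...   | inj₁ u<1+t = inj₁ (ℕ.≤-trans (ℕ.≤-pred u<1+t) (ℕ.m≤m⊔n t v′))
...   | inj₂ u≡1+t = inj₂ (u≡1+t , v′≤t)

reachable-noIsolated : ∀ {m v′ E₀ f t E} →
  InitialGraph m v′ E₀ → (∀ t → v′ ℕ.≤ t → 1 ℕ.≤ f t) →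
  Reachable m f E₀ t E → ∀ u → 1 ℕ.≤ u → u ℕ.≤ t ⊔ v′ → 1 ℕ.≤ deg E u
reachable-noIsolated G′ _ start u 1≤u u≤ =
  InitialGraph.noIsolated G′ u 1≤u (subst (u ℕ.≤_) (ℕ.m≤n⇒m⊔n≡n (InitialGraph.v'≥1 G′)) u≤)
reachable-noIsolated {m} {v′} {f = f} G′ f≥1 (step {t} {E} {ws = ws} reach ws∈choices _) u 1≤u u≤
  with ≤-suc-⊔ v′ u≤
... | inj₁ u≤t⊔v′ =
  ℕ.≤-trans (reachable-noIsolated G′ f≥1 reach u 1≤u u≤t⊔v′) (deg-≤-extend t E ws u)
... | inj₂ (refl , v′≤t) = begin
  1                                           ≤⟨ f≥1 t v′≤t ⟩
  f t                                         ≡⟨ choices-length m f t E ws∈choices ⟨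
  length ws                                   ≤⟨ length-≤-deg-star (suc t) ws ⟩
  deg (map (λ w → (suc t , w)) ws) (suc t)    ≤⟨ ℕ.m≤n+m _ (deg E (suc t)) ⟩
  deg E (suc t) ℕ.+ deg (map (λ w → (suc t , w)) ws) (suc t) ≡⟨ deg-++ E _ (suc t) ⟨
  deg (extend t E ws) (suc t)                 ∎
  where open ℕ.≤-Reasoning

-- Survival bound

survival : (ℕ → ℕ) → ℕ → ℕ → ℚ
survival f t zero    = 1ℚ
survival f t (suc n) = (1ℚ - frac 1 (2 ℕ.* F f t)) ^ f t * survival f (suc t) n

hazard : (ℕ → ℕ) → ℕ → ℕ → ℚ
hazard f t zero    = 0ℚ
hazard f t (suc n) = frac (f t) (2 ℕ.* F f t) + hazard f (suc t) n

0≤-survival : ∀ f t n → 0ℚ ≤ survival f t n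
0≤-survival f t zero    = 0≤-frac 1 1
0≤-survival f t (suc n) = 0≤-* (0≤-^ (f t) (0≤-1-frac-1 (2 ℕ.* F f t))) (0≤-survival f (suc t) n)

0≤-hazard : ∀ f t n → 0ℚ ≤ hazard f t n
0≤-hazard f t zero    = ℚ.≤-refl
0≤-hazard f t (suc n) = 0≤-+ (0≤-frac (f t) (2 ℕ.* F f t)) (0≤-hazard f (suc t) n)

avoid-≤-survival : ∀ m f u n {t E} → length E ≡ F f t → 1 ℕ.≤ deg E u → avoid m f u t E n ≤ survival f t n
avoid-≤-survival m f u zero    _    _ = ℚ.≤-refl
avoid-≤-survival m f u (suc n) {t} {E} size 1≤du =
  escape-choices-≤ m f t E size 1≤du (0≤-survival f (suc t) n) λ ws len →
    avoid-≤-survival m f u n (trans (length-extend t E ws) (cong₂ ℕ._+_ size len))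
                             (ℕ.≤-trans 1≤du (deg-≤-extend t E ws u))

-- (1 + h) (1 + H) ≥ 1 + (h + H) chains the stagewise Bernoulli inequalities.
survival*[1+hazard]≤1 : ∀ f t n → survival f t n * (1ℚ + hazard f t n) ≤ 1ℚ
survival*[1+hazard]≤1 f t zero    = ℚ.≤-reflexive (trans (ℚ.*-identityˡ _) (ℚ.+-identityʳ 1ℚ))
survival*[1+hazard]≤1 f t (suc n) = begin
  c * s * (1ℚ + (h + H))
    ≤⟨ p+q≡r⇒p≤r (factor c s h H) (0≤-* (0≤-* 0≤c 0≤s) (0≤-* 0≤h 0≤H)) ⟩
  c * (1ℚ + h) * (s * (1ℚ + H))
    ≤⟨ *-monoˡ-≤-0≤ (0≤-* 0≤c (0≤-+ (0≤-frac 1 1) 0≤h)) (survival*[1+hazard]≤1 f (suc t) n) ⟩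
  c * (1ℚ + h) * 1ℚ
    ≡⟨ ℚ.*-identityʳ (c * (1ℚ + h)) ⟩
  c * (1ℚ + h)
    ≡⟨ cong (λ y → c * (1ℚ + y)) (·-frac-1 (f t) D) ⟨
  c * (1ℚ + f t · frac 1 D)
    ≤⟨ bernoulli (0≤-frac 1 D) (frac-1-≤-1 D) (f t) ⟩
  1ℚ
    ∎
  where
  open ℚ.≤-Reasoning
  D = 2 ℕ.* F f t
  c = (1ℚ - frac 1 D) ^ f t
  s = survival f (suc t) n
  h = frac (f t) D
  H = hazard f (suc t) n
  0≤c = 0≤-^ (f t) (0≤-1-frac-1 D)
  0≤s = 0≤-survival f (suc t) n
  0≤h = 0≤-frac (f t) D
  0≤H = 0≤-hazard f (suc t) n
  factor : ∀ c s h H → c * s * (1ℚ + (h + H)) + c * s * (h * H) ≡ c * (1ℚ + h) * (s * (1ℚ + H))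
  factor = solve-∀ ℚ-ring

partialSum-mono : ∀ f k N → partialSum f N ≤ partialSum f (k ℕ.+ N)
partialSum-mono f zero    N = ℚ.≤-refl
partialSum-mono f (suc k) N =
  ℚ.≤-trans (partialSum-mono f k N) (p+q≡r⇒p≤r refl (0≤-frac (f (suc (k ℕ.+ N))) (F f (suc (k ℕ.+ N)))))

partialSum-≤-F : ∀ f t → partialSum f t ≤ mkℚℕ (F f (suc t))
partialSum-≤-F f zero    = 0≤-frac (F f 1) 1
partialSum-≤-F f (suc t) = ℚ.≤-trans
  (ℚ.+-mono-≤ (partialSum-≤-F f t) (frac-≤-mkℚℕ (f (suc t)) (F f (suc t))))
  (ℚ.≤-reflexive (frac-+ (F f (suc t)) (f (suc t)) 1))

partialSum-≤-hazard : ∀ f n t →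
  partialSum f (t ℕ.+ n) ≤ partialSum f t + (hazard f (suc t) n + hazard f (suc t) n)
partialSum-≤-hazard f zero t rewrite ℕ.+-identityʳ t =
  ℚ.≤-reflexive (sym (trans (cong (partialSum f t +_) (ℚ.+-identityʳ 0ℚ)) (ℚ.+-identityʳ (partialSum f t))))
partialSum-≤-hazard f (suc n) t rewrite ℕ.+-suc t n = begin
  partialSum f (suc t ℕ.+ n)
    ≤⟨ partialSum-≤-hazard f n (suc t) ⟩
  partialSum f t + frac (f (suc t)) (F f (suc t)) + (H + H)
    ≤⟨ ℚ.+-monoˡ-≤ (H + H) (ℚ.+-monoʳ-≤ (partialSum f t) (frac-≤-halves (f (suc t)) (F f (suc t)))) ⟩
  partialSum f t + (h + h) + (H + H)
    ≡⟨ regroup (partialSum f t) h H ⟩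
  partialSum f t + ((h + H) + (h + H))
    ∎
  where
  open ℚ.≤-Reasoning
  h = frac (f (suc t)) (2 ℕ.* F f (suc t))
  H = hazard f (suc (suc t)) n
  regroup : ∀ P h H → P + (h + h) + (H + H) ≡ P + ((h + H) + (h + H))
  regroup = solve-∀ ℚ-ring

hazard-unbounded : ∀ f → (∀ B → ∃[ N ] mkℚℕ B ≤ partialSum f N) →
  ∀ t K → ∃[ n ] mkℚℕ K ≤ hazard f (suc t) n
hazard-unbounded f diverges t K = N , p+[q+q]≤p+[r+r]⇒q≤r (mkℚℕ B) (begin
  mkℚℕ B + (mkℚℕ K + mkℚℕ K)   ≡⟨ trans (cong (mkℚℕ B +_) (frac-+ K K 1)) (frac-+ B (K ℕ.+ K) 1) ⟩
  mkℚℕ (B ℕ.+ (K ℕ.+ K))        ≤⟨ proj₂ (diverges (B ℕ.+ (K ℕ.+ K))) ⟩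
  partialSum f N                ≤⟨ partialSum-mono f t N ⟩
  partialSum f (t ℕ.+ N)        ≤⟨ partialSum-≤-hazard f N t ⟩
  partialSum f t + (H + H)      ≤⟨ ℚ.+-monoˡ-≤ (H + H) (partialSum-≤-F f t) ⟩
  mkℚℕ B + (H + H)              ∎)
  where
  open ℚ.≤-Reasoning
  B = F f (suc t)
  N = proj₁ (diverges (B ℕ.+ (K ℕ.+ K)))
  H = hazard f (suc t) N

*[1+H]≤1⇒< : ∀ {g H ε} → 0ℚ ≤ H → 0ℚ < ε → 1ℚ ≤ ε * H → g * (1ℚ + H) ≤ 1ℚ → g < ε
*[1+H]≤1⇒< {g} {H} {ε} 0≤H 0<ε 1≤εH g[1+H]≤1 =
  ℚ.*-cancelʳ-<-nonNeg (1ℚ + H) {{nonNegative (0≤-+ (0≤-frac 1 1) 0≤H)}} (begin-strict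
    g * (1ℚ + H)   ≤⟨ g[1+H]≤1 ⟩
    1ℚ             ≡⟨ ℚ.+-identityˡ 1ℚ ⟨
    0ℚ + 1ℚ        <⟨ ℚ.+-monoˡ-< 1ℚ 0<ε ⟩
    ε + 1ℚ         ≤⟨ ℚ.+-monoʳ-≤ ε 1≤εH ⟩
    ε + ε * H      ≡⟨ cong (_+ ε * H) (ℚ.*-identityʳ ε) ⟨
    ε * 1ℚ + ε * H ≡⟨ ℚ.*-distribˡ-+ ε 1ℚ H ⟨
    ε * (1ℚ + H)   ∎)
  where open ℚ.≤-Reasoning

lemma3p7 : (m : Model) (v' : ℕ) (E₀ : List Edge) → InitialGraph m v' E₀ →
    (f : ℕ → ℕ) → f 0 ≡ length E₀ →
    (∀ t → 1 Data.Nat.≤ t → suc t Data.Nat.≤ v' → f t ≡ 0) →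
    (∀ t → v' Data.Nat.≤ t → 1 Data.Nat.≤ f t) →
    (∀ (B : ℕ) → ∃[ N ] (mkℚℕ B Data.Rational.≤ partialSum f N)) →
    (m ≡ GPA → ∀ t → v' Data.Nat.≤ t → f t Data.Nat.≤ t) →
    ∀ (t₀ : ℕ) (E : List Edge) → 1 Data.Nat.≤ t₀ → Reachable m f E₀ t₀ E →
    ∀ (u : ℕ) → 1 Data.Nat.≤ u → u Data.Nat.≤ t₀ ⊔ v' →
    ∀ (ε : ℚ) → 0ℚ < ε → ∃[ n ] (avoid m f u t₀ E n < ε)
lemma3p7 m v' E₀ G′ f f0≡e′ _ f≥1 diverges _ (suc t) E (s≤s z≤n) reach u 1≤u u≤ ε 0<ε =
  n , ℚ.≤-<-trans
        (avoid-≤-survival m f u n (reachable-size f0≡e′ reach) (reachable-noIsolated G′ f≥1 reach u 1≤u u≤))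
        (*[1+H]≤1⇒< (0≤-hazard f (suc t) n) 0<ε 1≤εH (survival*[1+hazard]≤1 f (suc t) n))
  where
  open ℚ.≤-Reasoning
  K     = proj₁ (unit-fraction-≤ ε 0<ε)
  1/K≤ε = proj₂ (unit-fraction-≤ ε 0<ε)
  n     = proj₁ (hazard-unbounded f diverges t (suc K))
  K≤H   = proj₂ (hazard-unbounded f diverges t (suc K))
  1≤εH : 1ℚ ≤ ε * hazard f (suc t) n
  1≤εH = begin
    1ℚ                             ≡⟨ frac-1-*-inverse K ⟨
    frac 1 (suc K) * mkℚℕ (suc K)  ≤⟨ *-monoʳ-≤-0≤ (0≤-frac (suc K) 1) 1/K≤ε ⟩
    ε * mkℚℕ (suc K)               ≤⟨ *-monoˡ-≤-0≤ (ℚ.<⇒≤ 0<ε) K≤H ⟩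
    ε * hazard f (suc t) n         ∎
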